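{- Let $p$ be an odd integer, let $s,t$ be integers with $1 \le s,t\le p-1$, let $B=\{0,1,\dots,t-1\}\subseteq \mathbb{Z}_p$, and let $r$ be an integer. Define the multiset $M$ (of cardinality $p$) as follows: if $2t \le p-1$, $M$ consists of $p-2t+1$ copies of $0$, two copies of each of $1,2,\dots,t-1$, and one copy of $t$; if $2t \ge p+1$, $M$ consists of $2t-p+1$ copies of $2t-p$, two copies of each of $2t-p+1, 2t-p+2,\dots,t-1$, and one copy of $t$. Then there is a subset $A$ of $\mathbb{Z}_p$ with $|A|=s$ and $r(A,B,B)=r$ if and only if $M$ contains a sub-multiset of cardinality $s$ whose elements sum to $r$.
   Context: $\mathbb{Z}_p$ is the additive group of integers modulo $p$. $r(A,B,B)$ denotes the number of triples $(a,b,a+b)$ with $a\in A$, $b\in B$ and $a+b\in B$. A sub-multiset of cardinality $s$ means a choice of $s$ elements of $M$ counted with multiplicity not exceeding that in $M$. -}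

module Defs where

open import Data.Nat using (ℕ; zero; suc; _+_; _*_; _∸_; _≤?_; _<?_; NonZero)
open import Data.Nat.DivMod using (_%_)
open import Data.Fin using (Fin; toℕ)
open import Data.Fin.Subset using (Subset)
open import Data.Fin.Subset.Properties using (_∈?_)
open import Data.List using (List; []; _∷_; _++_; replicate; map; concatMap; upTo; allFin)
open import Data.Nat.ListAction using (sum)
open import Relation.Nullary.Decidable using (Dec; yes; no; does)
open import Data.Bool using (Bool; true; false; if_then_else_; _∧_)

-- B = {0,1,...,t-1} ⊆ ℤ_p ; membership of the residue x (given as a natural < p)
-- r(A,B,B) = #{(a,b) : a ∈ A, b ∈ B, a + b (mod p) ∈ B}
rABB : (p : ℕ) .{{_ : NonZero p}} → Subset p → ℕ → ℕ
rABB p A t = sum (map (λ a → sum (map (λ b → indicator a b) (allFin p))) (allFin p))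
  where
  indicator : Fin p → Fin p → ℕ
  indicator a b =
    if does (a ∈? A) ∧ does (toℕ b <? t) ∧ does (((toℕ a + toℕ b) % p) <? t)
    then 1 else 0

twoCopies : ℕ → ℕ → List ℕ
twoCopies a t = concatMap (λ i → (a + i) ∷ (a + i) ∷ []) (upTo (t ∸ a))

-- Case 2t ≤ p-1 : (p-2t+1) copies of 0, two copies of 1..t-1, one copy of t.
-- Otherwise (for odd p this is exactly 2t ≥ p+1):
--   (2t-p+1) copies of 2t-p, two copies of 2t-p+1..t-1, one copy of t.
M : ℕ → ℕ → List ℕ
M p t with 2 * t ≤? p ∸ 1
... | yes _ = replicate (p ∸ 2 * t + 1) 0 ++ twoCopies 1 t ++ (t ∷ [])
... | no _  = replicate (2 * t ∸ p + 1) (2 * t ∸ p) ++ twoCopies (2 * t ∸ p + 1) t ++ (t ∷ [])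

-- Sort the triples counted by r(A, B, B) by their first coordinate: a ∈ ℤ_p contributes
-- |(a + B) ∩ B| = (t − a)⁺ + (t + a − p)⁺ of them. So r(A, B, B) is the total weight of A,
-- and the s-subsets of ℤ_p realise exactly the sums of the s-sub-multisets of the multiset
-- of weights; it remains to see that this multiset is M. Writing p = t + q, the weight
-- sequence w_{t,q}(x) = (t − x)⁺ + (x − q)⁺, x < t + q, satisfies
-- w_{t+1,q+1} = (t + 1), w_{t,q}, t, and M grows by the same two elements t and t + 1.
module Submission where

open import Defs
open import Data.Bool using (Bool; true; false; if_then_else_; _∧_)
open import Data.Bool.Properties using (∧-zeroʳ)
open import Data.Fin using (Fin; zero; suc; toℕ)
open import Data.Fin.Subset using (Subset; ∣_∣; inside; outside)
open import Data.Fin.Subset.Properties using (_∈?_)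
open import Data.List
  using (List; []; _∷_; [_]; _++_; length; map; tabulate; allFin; applyUpTo; upTo; replicate; concatMap)
open import Data.List.Properties
  using (map-tabulate; tabulate-cong; applyUpTo-∷ʳ; upTo-∷ʳ; concatMap-++; ++-assoc; ++-identityʳ)
open import Data.List.Relation.Binary.Sublist.Propositional using (_⊆_; []; _∷_; _∷ʳ_)
import Data.List.Relation.Binary.Permutation.Propositional as ↭
open ↭ using (_↭_; ↭-refl; ↭-prep; ↭-swap; ↭-trans; ↭-sym; ↭-reflexive; module PermutationReasoning)
open import Data.List.Relation.Binary.Permutation.Propositional.Properties using (↭-length; ∷↭∷ʳ; ++⁺ʳ)
open import Data.Nat using (ℕ; zero; suc; _+_; _*_; _∸_; _≤_; _<_; _≤?_; _<?_; z≤n; s≤s; s≤s⁻¹; NonZero; ∣_-_∣)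
open import Data.Nat.Properties
open import Data.Nat.DivMod using (_%_; m<n⇒m%n≡m; [m+n]%n≡m%n)
open import Data.Nat.ListAction using (sum)
open import Data.Nat.ListAction.Properties using (sum-++; sum-↭)
open import Data.Vec using ([]; _∷_)
open import Data.Product using (∃; _×_; _,_)
open import Function using (_∘_; id)
open import Function.Bundles using (_⇔_; mk⇔)
open import Function.Construct.Composition using (_⇔-∘_)
open import Relation.Binary.PropositionalEquality using (_≡_; refl; sym; trans; cong; cong₂; subst; module ≡-Reasoning)
open import Relation.Nullary using (¬_)
open import Relation.Nullary.Decidable using (does; dec-true; dec-false; yes; no)

⊆-↭ : ∀ {X : Set} {xs ys N : List X} → xs ↭ ys → N ⊆ xs → ∃ λ N′ → N′ ⊆ ys × N ↭ N′
⊆-↭ ↭.refl N⊆ = _ , N⊆ , ↭-refl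
⊆-↭ (↭.prep x p) (_ ∷ʳ N⊆) =
  let N′ , N′⊆ , N↭N′ = ⊆-↭ p N⊆ in N′ , x ∷ʳ N′⊆ , N↭N′
⊆-↭ (↭.prep x p) (refl ∷ N⊆) =
  let N′ , N′⊆ , N↭N′ = ⊆-↭ p N⊆ in x ∷ N′ , refl ∷ N′⊆ , ↭-prep x N↭N′
⊆-↭ (↭.swap x y p) (_ ∷ʳ _ ∷ʳ N⊆) =
  let N′ , N′⊆ , N↭N′ = ⊆-↭ p N⊆ in N′ , y ∷ʳ x ∷ʳ N′⊆ , N↭N′
⊆-↭ (↭.swap x y p) (_ ∷ʳ refl ∷ N⊆) =
  let N′ , N′⊆ , N↭N′ = ⊆-↭ p N⊆ in y ∷ N′ , refl ∷ x ∷ʳ N′⊆ , ↭-prep y N↭N′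
⊆-↭ (↭.swap x y p) (refl ∷ _ ∷ʳ N⊆) =
  let N′ , N′⊆ , N↭N′ = ⊆-↭ p N⊆ in x ∷ N′ , y ∷ʳ refl ∷ N′⊆ , ↭-prep x N↭N′
⊆-↭ (↭.swap x y p) (refl ∷ refl ∷ N⊆) =
  let N′ , N′⊆ , N↭N′ = ⊆-↭ p N⊆ in y ∷ x ∷ N′ , refl ∷ refl ∷ N′⊆ , ↭-swap x y N↭N′
⊆-↭ (↭.trans p q) N⊆ =
  let N₁ , N₁⊆ , N↭N₁ = ⊆-↭ p N⊆
      N₂ , N₂⊆ , N₁↭N₂ = ⊆-↭ q N₁⊆
  in N₂ , N₂⊆ , ↭-trans N↭N₁ N₁↭N₂

∃-⊆-↭ : ∀ {X : Set} (P : List X → Set) → (∀ {N N′} → N ↭ N′ → P N → P N′) →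
        ∀ {xs ys} → xs ↭ ys → (∃ λ N → N ⊆ xs × P N) ⇔ (∃ λ N → N ⊆ ys × P N)
∃-⊆-↭ P P-resp xs↭ys = mk⇔ (transfer xs↭ys) (transfer (↭-sym xs↭ys))
  where
  transfer : ∀ {xs ys} → xs ↭ ys → (∃ λ N → N ⊆ xs × P N) → ∃ λ N → N ⊆ ys × P N
  transfer xs↭ys (N , N⊆ , PN) =
    let N′ , N′⊆ , N↭N′ = ⊆-↭ xs↭ys N⊆ in N′ , N′⊆ , P-resp N↭N′ PN

select : ∀ {X : Set} {n} → Subset n → (Fin n → X) → List X
select []            f = []
select (inside  ∷ S) f = f zero ∷ select S (f ∘ suc)
select (outside ∷ S) f = select S (f ∘ suc)

select-⊆ : ∀ {X : Set} {n} (S : Subset n) (f : Fin n → X) → select S f ⊆ tabulate f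
select-⊆ []            f = []
select-⊆ (inside  ∷ S) f = refl ∷ select-⊆ S (f ∘ suc)
select-⊆ (outside ∷ S) f = f zero ∷ʳ select-⊆ S (f ∘ suc)

length-select : ∀ {X : Set} {n} (S : Subset n) (f : Fin n → X) → length (select S f) ≡ ∣ S ∣
length-select []            f = refl
length-select (inside  ∷ S) f = cong suc (length-select S (f ∘ suc))
length-select (outside ∷ S) f = length-select S (f ∘ suc)

⊆-tabulate⇒select : ∀ {X : Set} {n} (f : Fin n → X) {N} → N ⊆ tabulate f → ∃ λ S → select S f ≡ N
⊆-tabulate⇒select {n = zero}  f []         = [] , refl
⊆-tabulate⇒select {n = suc n} f (_ ∷ʳ N⊆) =
  let S , sel≡N = ⊆-tabulate⇒select (f ∘ suc) N⊆ in outside ∷ S , sel≡N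
⊆-tabulate⇒select {n = suc n} f (refl ∷ N⊆) =
  let S , sel≡N = ⊆-tabulate⇒select (f ∘ suc) N⊆ in inside ∷ S , cong (f zero ∷_) sel≡N

∃-select⇔∃-⊆-tabulate : ∀ {X : Set} {n} (f : Fin n → X) (P : List X → Set) →
                        (∃ λ S → P (select S f)) ⇔ (∃ λ N → N ⊆ tabulate f × P N)
∃-select⇔∃-⊆-tabulate f P = mk⇔
  (λ (S , PS) → select S f , select-⊆ S f , PS)
  (λ (N , N⊆ , PN) → let S , sel≡N = ⊆-tabulate⇒select f N⊆ in S , subst P (sym sel≡N) PN)

sum-select : ∀ {n} (S : Subset n) (f : Fin n → ℕ) →
             sum (tabulate (λ i → if does (i ∈? S) then f i else 0)) ≡ sum (select S f)
sum-select []            f = refl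
sum-select (inside  ∷ S) f = cong (f zero +_) (sum-select S (f ∘ suc))
sum-select (outside ∷ S) f = sum-select S (f ∘ suc)

tabulate-toℕ : ∀ {X : Set} n (f : ℕ → X) → tabulate {n = n} (f ∘ toℕ) ≡ applyUpTo f n
tabulate-toℕ zero    f = refl
tabulate-toℕ (suc n) f = cong (f 0 ∷_) (tabulate-toℕ n (f ∘ suc))

applyUpTo-++ : ∀ {X : Set} (f : ℕ → X) m n → applyUpTo f (m + n) ≡ applyUpTo f m ++ applyUpTo (f ∘ (m +_)) n
applyUpTo-++ f zero    n = refl
applyUpTo-++ f (suc m) n = cong (f 0 ∷_) (applyUpTo-++ (f ∘ suc) m n)

applyUpTo-cong : ∀ {X : Set} {f g : ℕ → X} n → (∀ {x} → x < n → f x ≡ g x) → applyUpTo f n ≡ applyUpTo g n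
applyUpTo-cong zero    f≡g = refl
applyUpTo-cong (suc n) f≡g = cong₂ _∷_ (f≡g (s≤s z≤n)) (applyUpTo-cong n (f≡g ∘ s≤s))

applyUpTo-const : ∀ {X : Set} {f : ℕ → X} {c} n → (∀ {x} → x < n → f x ≡ c) → applyUpTo f n ≡ replicate n c
applyUpTo-const zero    f≡c = refl
applyUpTo-const (suc n) f≡c = cong₂ _∷_ (f≡c (s≤s z≤n)) (applyUpTo-const n (f≡c ∘ s≤s))

replicate-∷ʳ : ∀ {X : Set} n (x : X) → replicate n x ++ [ x ] ≡ replicate (n + 1) x
replicate-∷ʳ zero    x = refl
replicate-∷ʳ (suc n) x = cong (x ∷_) (replicate-∷ʳ n x)

sum-applyUpTo-indicator : ∀ (f : ℕ → ℕ) {n} k → k ≤ n →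
                          (∀ {b} → b < k → f b ≡ 1) → (∀ {b} → k ≤ b → b < n → f b ≡ 0) →
                          sum (applyUpTo f n) ≡ k
sum-applyUpTo-indicator f {zero}  zero    _         _   _   = refl
sum-applyUpTo-indicator f {suc n} zero    _         _   f≡0 =
  cong₂ _+_ (f≡0 z≤n (s≤s z≤n))
            (sum-applyUpTo-indicator (f ∘ suc) zero z≤n (λ ()) (λ _ b<n → f≡0 z≤n (s≤s b<n)))
sum-applyUpTo-indicator f {suc n} (suc k) (s≤s k≤n) f≡1 f≡0 =
  cong₂ _+_ (f≡1 (s≤s z≤n))
            (sum-applyUpTo-indicator (f ∘ suc) k k≤n (f≡1 ∘ s≤s) (λ k≤b b<n → f≡0 (s≤s k≤b) (s≤s b<n)))

m<n∸o⇒o+m<n : ∀ m n o → m < n ∸ o → o + m < n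
m<n∸o⇒o+m<n m n       zero    m<n   = m<n
m<n∸o⇒o+m<n m (suc n) (suc o) m<n∸o = s≤s (m<n∸o⇒o+m<n m n o m<n∸o)

m∸n≤o⇒m≤n+o : ∀ m n {o} → m ∸ n ≤ o → m ≤ n + o
m∸n≤o⇒m≤n+o m n m∸n≤o = ≤-trans (m≤n+m∸n m n) (+-monoʳ-≤ n m∸n≤o)

m∸[n∸o]≡m+o∸n : ∀ m {n o} → o ≤ n → m ∸ (n ∸ o) ≡ m + o ∸ n
m∸[n∸o]≡m+o∸n m {n} {o} o≤n = begin
  m ∸ (n ∸ o)              ≡⟨ sym ([m+n]∸[m+o]≡n∸o o m (n ∸ o)) ⟩
  o + m ∸ (o + (n ∸ o))    ≡⟨ cong₂ _∸_ (+-comm o m) (m+[n∸m]≡n o≤n) ⟩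
  m + o ∸ n                ∎
  where open ≡-Reasoning

overlapCount : (p : ℕ) .{{_ : NonZero p}} → ℕ → ℕ → ℕ
overlapCount p t x = sum (applyUpTo (λ b → if does (b <? t) ∧ does ((x + b) % p <? t) then 1 else 0) p)

weight : (p : ℕ) .{{_ : NonZero p}} → ℕ → Fin p → ℕ
weight p t a = overlapCount p t (toℕ a)

rABB≡sum-select : (p : ℕ) .{{_ : NonZero p}} (A : Subset p) (t : ℕ) →
                  rABB p A t ≡ sum (select A (weight p t))
rABB≡sum-select p A t =
  trans (cong sum (trans (map-tabulate id _) (tabulate-cong (λ a → row (does (a ∈? A)) a))))
        (sum-select A (weight p t))
  where
  indicator : Bool → ℕ → ℕ → ℕ
  indicator a∈A x b = if a∈A ∧ does (b <? t) ∧ does ((x + b) % p <? t) then 1 else 0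
  row : ∀ a∈A (a : Fin p) → sum (map (indicator a∈A (toℕ a) ∘ toℕ) (allFin p))
                            ≡ (if a∈A then overlapCount p t (toℕ a) else 0)
  row a∈A a = trans (cong sum (trans (map-tabulate id _) (tabulate-toℕ p (indicator a∈A (toℕ a)))))
                    (cases a∈A)
    where
    cases : ∀ a∈A → sum (applyUpTo (indicator a∈A (toℕ a)) p) ≡ (if a∈A then overlapCount p t (toℕ a) else 0)
    cases true  = refl
    cases false = sum-applyUpTo-indicator (indicator false (toℕ a)) {p} 0 z≤n (λ ()) (λ _ _ → refl)

overlapCount-formula : (p : ℕ) .{{_ : NonZero p}} {t x : ℕ} → t ≤ p → x < p →
                       overlapCount p t x ≡ (t ∸ x) + (t + x ∸ p)
overlapCount-formula p {t} {x} t≤p x<p = begin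
  sum (applyUpTo f p)                                   ≡⟨ cong (sum ∘ applyUpTo f) (sym y+x≡p) ⟩
  sum (applyUpTo f (y + x))                             ≡⟨ cong sum (applyUpTo-++ f y x) ⟩
  sum (applyUpTo f y ++ applyUpTo (f ∘ (y +_)) x)       ≡⟨ sum-++ (applyUpTo f y) _ ⟩
  sum (applyUpTo f y) + sum (applyUpTo (f ∘ (y +_)) x)  ≡⟨ cong₂ _+_ unwrapped wrapped ⟩
  (t ∸ x) + (t ∸ y)                                     ≡⟨ cong ((t ∸ x) +_) (m∸[n∸o]≡m+o∸n t x≤p) ⟩
  (t ∸ x) + (t + x ∸ p)                                 ∎
  where
  open ≡-Reasoning
  f : ℕ → ℕ
  f b = if does (b <? t) ∧ does ((x + b) % p <? t) then 1 else 0
  y = p ∸ x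
  x≤p = <⇒≤ x<p
  y+x≡p : y + x ≡ p
  y+x≡p = m∸n+n≡m x≤p

  f≡1 : ∀ {b} → b < t → (x + b) % p < t → f b ≡ 1
  f≡1 {b} b<t x+b<t rewrite dec-true (b <? t) b<t | dec-true ((x + b) % p <? t) x+b<t = refl
  f≡0ˡ : ∀ {b} → ¬ b < t → f b ≡ 0
  f≡0ˡ {b} b≮t rewrite dec-false (b <? t) b≮t = refl
  f≡0ʳ : ∀ {b} → ¬ (x + b) % p < t → f b ≡ 0
  f≡0ʳ {b} ≮t rewrite dec-false ((x + b) % p <? t) ≮t | ∧-zeroʳ (does (b <? t)) = refl

  -- Below y = p − x the sum x + b does not wrap around p; above, x + (y + j) ≡ j (mod p).
  unwrapped : sum (applyUpTo f y) ≡ t ∸ x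
  unwrapped = sum-applyUpTo-indicator f (t ∸ x) (∸-monoˡ-≤ x t≤p) below above
    where
    below : ∀ {b} → b < t ∸ x → f b ≡ 1
    below {b} b<t∸x = f≡1 (≤-<-trans (m≤n+m b x) x+b<t) (subst (_< t) (sym (m<n⇒m%n≡m (<-≤-trans x+b<t t≤p))) x+b<t)
      where x+b<t = m<n∸o⇒o+m<n b t x b<t∸x
    above : ∀ {b} → t ∸ x ≤ b → b < y → f b ≡ 0
    above {b} t∸x≤b b<y = f≡0ʳ (λ lt → <⇒≱ (subst (_< t) (m<n⇒m%n≡m x+b<p) lt) (m∸n≤o⇒m≤n+o t x t∸x≤b))
      where x+b<p = subst (x + b <_) (trans (+-comm x y) y+x≡p) (+-monoʳ-< x b<y)

  wrapped : sum (applyUpTo (f ∘ (y +_)) x) ≡ t ∸ y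
  wrapped = sum-applyUpTo-indicator (f ∘ (y +_)) (t ∸ y) t∸y≤x below above
    where
    t∸y≤x : t ∸ y ≤ x
    t∸y≤x = m≤n+o⇒m∸n≤o t y (subst (t ≤_) (sym y+x≡p) t≤p)
    mod≡ : ∀ {j} → j < x → (x + (y + j)) % p ≡ j
    mod≡ {j} j<x = begin
      (x + (y + j)) % p  ≡⟨ cong (_% p) (trans (sym (+-assoc x y j)) (cong (_+ j) (trans (+-comm x y) y+x≡p))) ⟩
      (p + j) % p        ≡⟨ cong (_% p) (+-comm p j) ⟩
      (j + p) % p        ≡⟨ [m+n]%n≡m%n j p ⟩
      j % p              ≡⟨ m<n⇒m%n≡m (<-trans j<x x<p) ⟩
      j                  ∎
    below : ∀ {j} → j < t ∸ y → f (y + j) ≡ 1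
    below {j} j<t∸y = f≡1 y+j<t (subst (_< t) (sym (mod≡ (<-≤-trans j<t∸y t∸y≤x))) (≤-<-trans (m≤n+m j y) y+j<t))
      where y+j<t = m<n∸o⇒o+m<n j t y j<t∸y
    above : ∀ {j} → t ∸ y ≤ j → j < x → f (y + j) ≡ 0
    above t∸y≤j _ = f≡0ˡ (≤⇒≯ (m∸n≤o⇒m≤n+o t y t∸y≤j))

-- the weights for p = t + q, by overlapCount-formula and t + x ∸ p ≡ x ∸ q
profile : ℕ → ℕ → List ℕ
profile t q = applyUpTo (λ x → (t ∸ x) + (x ∸ q)) (t + q)

Mform : ℕ → ℕ → ℕ → List ℕ
Mform c v t = replicate (c + 1) v ++ twoCopies (v + 1) t ++ [ t ]

-- For t, q ≥ 1 this is M (t + q) t; the clauses for t = 0 and q = 0 let profile↭shape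
-- induct down to 0.
shape : ℕ → ℕ → List ℕ
shape zero    q       = replicate q 0
shape (suc t) zero    = replicate (suc t) (suc t)
shape (suc t) (suc q) = Mform ∣ t - q ∣ (t ∸ q) (suc t)

profile-zeroˡ : ∀ q → profile 0 q ≡ replicate q 0
profile-zeroˡ q = applyUpTo-const q (λ {x} x<q → cong₂ _+_ (0∸n≡0 x) (m≤n⇒m∸n≡0 (<⇒≤ x<q)))

profile-zeroʳ : ∀ t → profile t 0 ≡ replicate t t
profile-zeroʳ t = trans (cong (applyUpTo _) (+-identityʳ t)) (applyUpTo-const t (λ x<t → m∸n+n≡m (<⇒≤ x<t)))

profile-suc : ∀ t q → profile (suc t) (suc q) ≡ suc t ∷ profile t q ++ [ t ]
profile-suc t q = cong₂ _∷_ (+-identityʳ (suc t)) (begin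
  applyUpTo w (t + suc q)            ≡⟨ cong (applyUpTo w) (+-suc t q) ⟩
  applyUpTo w (suc (t + q))          ≡⟨ sym (applyUpTo-∷ʳ w (t + q)) ⟩
  profile t q ++ [ w (t + q) ]       ≡⟨ cong (λ v → profile t q ++ [ v ]) w[t+q]≡t ⟩
  profile t q ++ [ t ]               ∎)
  where
  open ≡-Reasoning
  w : ℕ → ℕ
  w x = (t ∸ x) + (x ∸ q)
  w[t+q]≡t : w (t + q) ≡ t
  w[t+q]≡t = cong₂ _+_ (m≤n⇒m∸n≡0 (m≤m+n t q)) (m+n∸n≡m t q)

twoCopies-suc : ∀ {k t} → k ≤ t → twoCopies k (suc t) ≡ twoCopies k t ++ t ∷ t ∷ []
twoCopies-suc {k} {t} k≤t = begin
  concatMap g (upTo (suc t ∸ k))                ≡⟨ cong (concatMap g ∘ upTo) (+-∸-assoc 1 k≤t) ⟩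
  concatMap g (upTo (suc (t ∸ k)))              ≡⟨ cong (concatMap g) (sym (upTo-∷ʳ (t ∸ k))) ⟩
  concatMap g (upTo (t ∸ k) ++ [ t ∸ k ])       ≡⟨ concatMap-++ g (upTo (t ∸ k)) [ t ∸ k ] ⟩
  twoCopies k t ++ g (t ∸ k) ++ []              ≡⟨ cong (λ xs → twoCopies k t ++ xs) (++-identityʳ (g (t ∸ k))) ⟩
  twoCopies k t ++ g (t ∸ k)                    ≡⟨ cong (λ n → twoCopies k t ++ n ∷ n ∷ []) (m+[n∸m]≡n k≤t) ⟩
  twoCopies k t ++ t ∷ t ∷ []                   ∎
  where
  open ≡-Reasoning
  g : ℕ → List ℕ
  g i = (k + i) ∷ (k + i) ∷ []

twoCopies-empty : ∀ {k t} → t ≤ k → twoCopies k t ≡ []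
twoCopies-empty {k} t≤k = cong (λ n → concatMap (λ i → (k + i) ∷ (k + i) ∷ []) (upTo n)) (m≤n⇒m∸n≡0 t≤k)

shape-suc : ∀ t q → shape (suc t) (suc q) ≡ (shape t q ++ [ t ]) ++ [ suc t ]
shape-suc zero q rewrite 0∸n≡0 q = cong (_++ [ 1 ]) (sym (replicate-∷ʳ q 0))
shape-suc (suc t) zero = cong₂ (λ xs ys → xs ++ ys ++ [ suc (suc t) ]) (sym (replicate-∷ʳ (suc t) (suc t)))
                                 (twoCopies-empty (≤-reflexive (+-comm 1 (suc t))))
shape-suc (suc t) (suc q) = begin
  R ++ twoCopies k (suc (suc t)) ++ [ t₂ ]          ≡⟨ cong (λ xs → R ++ xs ++ [ t₂ ]) (twoCopies-suc k≤1+t) ⟩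
  R ++ (T ++ t₁ ∷ t₁ ∷ []) ++ [ t₂ ]                ≡⟨ cong (R ++_) (++-assoc T (t₁ ∷ t₁ ∷ []) [ t₂ ]) ⟩
  R ++ T ++ t₁ ∷ t₁ ∷ t₂ ∷ []                       ≡⟨ cong (R ++_) (++-assoc T [ t₁ ] (t₁ ∷ t₂ ∷ [])) ⟨
  R ++ (T ++ [ t₁ ]) ++ t₁ ∷ t₂ ∷ []                ≡⟨ ++-assoc R (T ++ [ t₁ ]) (t₁ ∷ t₂ ∷ []) ⟨
  (R ++ T ++ [ t₁ ]) ++ t₁ ∷ t₂ ∷ []                ≡⟨ ++-assoc (R ++ T ++ [ t₁ ]) [ t₁ ] [ t₂ ] ⟨
  ((R ++ T ++ [ t₁ ]) ++ [ t₁ ]) ++ [ t₂ ]          ∎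
  where
  open ≡-Reasoning
  t₁ = suc t
  t₂ = suc t₁
  k = t ∸ q + 1
  R = replicate (∣ t - q ∣ + 1) (t ∸ q)
  T = twoCopies k t₁
  k≤1+t : k ≤ t₁
  k≤1+t = ≤-trans (+-monoˡ-≤ 1 (m∸n≤m t q)) (≤-reflexive (+-comm t 1))

profile↭shape : ∀ t q → profile t q ↭ shape t q
profile↭shape zero    q       = ↭-reflexive (profile-zeroˡ q)
profile↭shape (suc t) zero    = ↭-reflexive (profile-zeroʳ (suc t))
profile↭shape (suc t) (suc q) = begin
  profile (suc t) (suc q)                 ≡⟨ profile-suc t q ⟩
  suc t ∷ profile t q ++ [ t ]            ↭⟨ ∷↭∷ʳ (suc t) _ ⟩
  (profile t q ++ [ t ]) ++ [ suc t ]     ↭⟨ ++⁺ʳ _ (++⁺ʳ _ (profile↭shape t q)) ⟩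
  (shape t q ++ [ t ]) ++ [ suc t ]       ≡⟨ shape-suc t q ⟨
  shape (suc t) (suc q)                   ∎
  where open PermutationReasoning

2*m≡m+m : ∀ m → 2 * m ≡ m + m
2*m≡m+m m = cong (m +_) (+-identityʳ m)

M≡shape : ∀ t q → M (suc t + suc q) (suc t) ≡ shape (suc t) (suc q)
M≡shape t q with 2 * suc t ≤? suc t + suc q ∸ 1
... | yes 2t≤p∸1 = cong₂ (λ c v → Mform c v (suc t)) c≡ v≡
  where
  t≤q : t ≤ q
  t≤q = s≤s⁻¹ (+-cancelˡ-≤ (suc t) (suc t) (suc q)
          (≤-trans (≤-reflexive (sym (2*m≡m+m (suc t)))) (≤-trans 2t≤p∸1 (n≤1+n _))))
  v≡ : 0 ≡ t ∸ q
  v≡ = sym (m≤n⇒m∸n≡0 t≤q)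
  c≡ : suc t + suc q ∸ 2 * suc t ≡ ∣ t - q ∣
  c≡ = trans (cong (suc t + suc q ∸_) (2*m≡m+m (suc t)))
             (trans ([m+n]∸[m+o]≡n∸o (suc t) (suc q) (suc t)) (sym (m≤n⇒∣m-n∣≡n∸m t≤q)))
... | no  2t≰p∸1 = cong₂ (λ c v → Mform c v (suc t)) c≡ v≡
  where
  q≤t : q ≤ t
  q≤t = s≤s⁻¹ (+-cancelˡ-≤ (suc t) (suc q) (suc t) (≤-trans (≰⇒> 2t≰p∸1) (≤-reflexive (2*m≡m+m (suc t)))))
  v≡ : 2 * suc t ∸ (suc t + suc q) ≡ t ∸ q
  v≡ = trans (cong (_∸ (suc t + suc q)) (2*m≡m+m (suc t))) ([m+n]∸[m+o]≡n∸o (suc t) (suc t) (suc q))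
  c≡ : 2 * suc t ∸ (suc t + suc q) ≡ ∣ t - q ∣
  c≡ = trans v≡ (sym (m≤n⇒∣n-m∣≡n∸m q≤t))

tabulate-weight↭M : ∀ p .{{_ : NonZero p}} {t} → 1 ≤ t → t ≤ p ∸ 1 → tabulate (weight p t) ↭ M p t
tabulate-weight↭M (suc p) {suc t} _ 1+t≤p = begin
  tabulate (weight P T)                ≡⟨ tabulate-toℕ P (overlapCount P T) ⟩
  applyUpTo (overlapCount P T) P       ≡⟨ applyUpTo-cong P overlapCount≡w ⟩
  applyUpTo w P                        ≡⟨ cong (applyUpTo w) (sym T+Q≡P) ⟩
  profile T Q                          ↭⟨ profile↭shape T Q ⟩
  shape T Q                            ≡⟨ M≡shape t q ⟨
  M (T + Q) T                          ≡⟨ cong (λ n → M n T) T+Q≡P ⟩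
  M P T                                ∎
  where
  open PermutationReasoning
  P = suc p
  T = suc t
  q = p ∸ T
  Q = suc q
  T+Q≡P : T + Q ≡ P
  T+Q≡P = trans (+-suc T q) (cong suc (m+[n∸m]≡n 1+t≤p))
  w : ℕ → ℕ
  w x = (T ∸ x) + (x ∸ Q)
  overlapCount≡w : ∀ {x} → x < P → overlapCount P T x ≡ w x
  overlapCount≡w {x} x<P = trans (overlapCount-formula P (≤-trans 1+t≤p (n≤1+n p)) x<P)
    (cong ((T ∸ x) +_) (trans (cong (T + x ∸_) (sym T+Q≡P)) ([m+n]∸[m+o]≡n∸o T x Q)))

open import Data.Integer using (ℤ; +_)

lemma1 : (p : ℕ) → .{{_ : NonZero p}} → p % 2 ≡ 1 →
         (s t : ℕ) → 1 ≤ s → s ≤ p ∸ 1 → 1 ≤ t → t ≤ p ∸ 1 →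
         (r : ℤ) →
         (∃ λ (A : Subset p) → ∣ A ∣ ≡ s × + rABB p A t ≡ r)
         ⇔ (∃ λ (N : List ℕ) → N ⊆ M p t × length N ≡ s × + sum N ≡ r)
lemma1 p _ s t _ _ 1≤t t≤p∸1 r =
  ∃-⊆-↭ P P-resp-↭ (tabulate-weight↭M p 1≤t t≤p∸1)
    ⇔-∘ (∃-select⇔∃-⊆-tabulate (weight p t) P ⇔-∘ rABB-as-select)
  where
  P : List ℕ → Set
  P N = length N ≡ s × + sum N ≡ r
  P-resp-↭ : ∀ {N N′} → N ↭ N′ → P N → P N′
  P-resp-↭ N↭N′ (|N|≡s , ΣN≡r) =
    trans (sym (↭-length N↭N′)) |N|≡s , trans (cong +_ (sym (sum-↭ N↭N′))) ΣN≡r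
  rABB-as-select : (∃ λ A → ∣ A ∣ ≡ s × + rABB p A t ≡ r) ⇔ (∃ λ A → P (select A (weight p t)))
  rABB-as-select = mk⇔
    (λ (A , |A|≡s , rABB≡r) → A , trans (length-select A (weight p t)) |A|≡s ,
                                  trans (cong +_ (sym (rABB≡sum-select p A t))) rABB≡r)
    (λ (A , |A|≡s , Σ≡r) → A , trans (sym (length-select A (weight p t))) |A|≡s ,
                               trans (cong +_ (rABB≡sum-select p A t)) Σ≡r)
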